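{- Let $m,n\ge 1$ and let $D$ be an $m$-Dyck path of height $n$. Then the out-degree of $D$ in the $\nu$-Tamari poset for $\nu=(NE^m)^n$ equals $n-1$ if and only if the left area vector $\mathbf{LA}_D$ consists of $n$ distinct numbers.
   Context: For $\nu=(NE^m)^n$ (a lattice path from $(0,0)$ to $(mn,n)$ with unit north steps $N$ and east steps $E$), an $m$-Dyck path of height $n$ is a lattice path from $(0,0)$ to $(mn,n)$ with $N$ and $E$ steps lying weakly above $\nu$. For such a path $D$ and $i\in[n]$, $r_i^D$ is the point of $D$ immediately before its $i$-th north step, and the left area vector is $\mathbf{LA}_D=(\mathbf{LA}_D(1),\dots,\mathbf{LA}_D(n))$ where $\mathbf{LA}_D(i)$ is the $x$-coordinate of $r_i^D$. For $p=(x,y)$ on $D$, $\mathrm{horiz}(p)=X(y)-x$ where $X(y)$ is the largest $x$-coordinate of a point of $\nu$ at height $y$. The touch point $t_i^D$ is the first point after $r_i^D$ on $D$ with the same horizontal distance as $r_i^D$. If $r_i^D$ is preceded by an east step, write $D=dEtf$ ($dE$ = subpath from $(0,0)$ to $r_i^D$, $t$ = subpath from $r_i^D$ to $t_i^D$, $f$ = the rest) and set $D\uparrow_i=dtEf$. The $\nu$-Tamari order is the partial order on these paths whose cover relations are $D\lessdot D\uparrow_i$ whenever defined; the out-degree of $D$ is the number of elements covering $D$. -}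

module Defs where

open import Data.Nat using (ℕ; zero; suc; _+_; _*_; _∸_; _≤_; _<_)
open import Data.List using (List; []; _∷_; _++_; length)
open import Data.List.Relation.Unary.Unique.Propositional using (Unique)
open import Data.List.Membership.Propositional using (_∈_)
open import Data.Product using (Σ; ∃; ∃-syntax; _×_; _,_)
open import Function.Bundles using (_⇔_)
open import Relation.Binary.PropositionalEquality using (_≡_; _≢_)

data Step : Set where
  N E : Step

Path : Set
Path = List Step

-- number of north / east steps (= y / x coordinate of the endpoint)
#N : Path → ℕ
#N []       = 0
#N (N ∷ s)  = suc (#N s)
#N (E ∷ s)  = #N s

#E : Path → ℕ
#E []       = 0
#E (N ∷ s)  = #E s
#E (E ∷ s)  = suc (#E s)

-- For ν = (N E^m)^n, the largest x-coordinate of a point of ν at height y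
-- is X(y) = m*y.  The endpoint of a prefix p is the point (#E p, #N p),
-- so horiz of that point is m * #N p - #E p (non-negative on paths above ν).
horiz : ℕ → Path → ℕ
horiz m p = m * #N p ∸ #E p

IsDyck : ℕ → ℕ → Path → Set
IsDyck m n D =
  #N D ≡ n × #E D ≡ m * n ×
  (∀ p q → D ≡ p ++ q → #E p ≤ m * #N p)

-- Left area vector: the x-coordinates of the points immediately before
-- each north step, listed in order (i = 1, …, n).
LA-from : ℕ → Path → List ℕ
LA-from x []       = []
LA-from x (N ∷ s)  = x ∷ LA-from x s
LA-from x (E ∷ s)  = LA-from (suc x) s

LA : Path → List ℕ
LA = LA-from 0

-- D = d E t f, where d E ends at r_i^D (so the next step, the first step
-- of t, is the i-th north step: #N (d E) = i - 1), and t ends at the touch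
-- point t_i^D: the first point after r_i^D with the same horizontal
-- distance as r_i^D.
Up : ℕ → Path → ℕ → Path → Set
Up m D i D' =
  Σ Path λ d → Σ Path λ t → Σ Path λ f →
    (D ≡ d ++ (E ∷ t ++ f)) ×
    (suc (#N d) ≡ i) ×
    (Σ Path λ t' → t ≡ N ∷ t') ×
    (horiz m (d ++ E ∷ t) ≡ horiz m (d ++ E ∷ [])) ×
    (∀ p q → t ≡ p ++ q → p ≢ [] → q ≢ [] →
       horiz m (d ++ E ∷ p) ≢ horiz m (d ++ E ∷ [])) ×
    (D' ≡ d ++ t ++ (E ∷ f))

Covers : ℕ → ℕ → Path → Path → Set
Covers m n D D' = ∃[ i ] (1 ≤ i × i ≤ n × Up m D i D')

OutDegree : ℕ → ℕ → Path → ℕ → Set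
OutDegree m n D k =
  ∃[ L ] (Unique L × (∀ D' → (D' ∈ L) ⇔ Covers m n D D') × length L ≡ k)

-- D↑_i is defined exactly when the i-th north step of D follows an east step,
-- i.e. at a valley EN of D, and its touch point is then forced: the north step
-- raises the horizontal distance by m, and t_i^D is the first point where the
-- rest of D has lowered it by m again (such a point exists because D ends at
-- distance 0 and east steps lower it one at a time). So the covers of D
-- correspond bijectively to its valleys. A Dyck path starts with N, and every
-- later north step follows either an E or an N, so n − 1 = #valleys + #NN.
-- Finally LA_D is weakly increasing, with two consecutive entries equal exactly
-- at a factor NN; hence LA_D has distinct entries iff D has no factor NN, iff
-- the out-degree is n − 1.
module Submission where

open import Defs
open import Data.Nat using (ℕ; zero; suc; _+_; _*_; _∸_; _≤_; z≤n; s≤s)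
open import Data.Nat.Properties
open import Data.List using (List; []; _∷_; _++_; length; map)
open import Data.List.Properties using (++-assoc; ++-conicalʳ; ∷-injectiveʳ; length-map)
open import Data.List.Relation.Unary.All as All using (All; []; _∷_)
open import Data.List.Relation.Unary.All.Properties as All using ()
open import Data.List.Relation.Unary.AllPairs using ([]; _∷_)
open import Data.List.Relation.Unary.Any using (here; there)
open import Data.List.Relation.Unary.Unique.Propositional using (Unique)
open import Data.List.Relation.Unary.Unique.Propositional.Properties as Unique using ()
open import Data.List.Relation.Binary.BagAndSetEquality using (∼bag⇒↭)
open import Data.List.Relation.Binary.Permutation.Propositional.Properties using (↭-length)
open import Data.List.Membership.Propositional using (_∈_)
open import Data.List.Membership.Propositional.Properties using (∈-map⁺; ∈-map⁻)
open import Data.List.Membership.Propositional.Properties.WithK using (unique∧set⇒bag)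
open import Data.Product using (∃; ∃₂; _×_; _,_; proj₁; proj₂; map₁)
open import Data.Empty using (⊥-elim)
open import Function.Base using (_∘_)
open import Function.Bundles using (_⇔_; mk⇔; Equivalence)
open import Function.Properties.Equivalence as ⇔ using (⇔-setoid)
open import Level using (0ℓ)
open import Relation.Binary.PropositionalEquality
open import Relation.Nullary using (¬_; contradiction)

open Equivalence using (to; from)

#N-++ : ∀ p q → #N (p ++ q) ≡ #N p + #N q
#N-++ []      q = refl
#N-++ (N ∷ p) q = cong suc (#N-++ p q)
#N-++ (E ∷ p) q = #N-++ p q

#E-++ : ∀ p q → #E (p ++ q) ≡ #E p + #E q
#E-++ []      q = refl
#E-++ (N ∷ p) q = #E-++ p q
#E-++ (E ∷ p) q = cong suc (#E-++ p q)

[m+o]∸[n+p]≡m∸n⇔o≡p : ∀ m n o p → n ≤ m → n + p ≤ m + o →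
                       ((m + o) ∸ (n + p) ≡ m ∸ n) ⇔ (o ≡ p)
[m+o]∸[n+p]≡m∸n⇔o≡p m n o p n≤m n+p≤m+o = mk⇔ cancel (λ { refl → shift })
  where
  open ≡-Reasoning
  cancel : (m + o) ∸ (n + p) ≡ m ∸ n → o ≡ p
  cancel eq = +-cancelˡ-≡ m o p (begin
    m + o                         ≡⟨ m∸n+n≡m n+p≤m+o ⟨
    (m + o) ∸ (n + p) + (n + p)   ≡⟨ cong (_+ (n + p)) eq ⟩
    (m ∸ n) + (n + p)             ≡⟨ +-assoc (m ∸ n) n p ⟨
    (m ∸ n) + n + p               ≡⟨ cong (_+ p) (m∸n+n≡m n≤m) ⟩
    m + p                         ∎)
  shift : (m + o) ∸ (n + o) ≡ m ∸ n
  shift = begin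
    (m + o) ∸ (n + o)   ≡⟨ cong₂ _∸_ (+-comm m o) (+-comm n o) ⟩
    (o + m) ∸ (o + n)   ≡⟨ [m+n]∸[m+o]≡n∸o o m n ⟩
    m ∸ n               ∎

n≡m+n⇔m≡0 : ∀ m n → (n ≡ m + n) ⇔ (m ≡ 0)
n≡m+n⇔m≡0 m n = mk⇔ (λ eq → sym (+-cancelʳ-≡ n 0 m eq)) (λ { refl → refl })

unique∧set⇒length≡ : ∀ {A : Set} {xs ys : List A} →
  Unique xs → Unique ys → (∀ {z} → (z ∈ xs) ⇔ (z ∈ ys)) → length xs ≡ length ys
unique∧set⇒length≡ uxs uys same =
  ↭-length (∼bag⇒↭ (unique∧set⇒bag uxs uys same))

m*#N-after-E : ∀ m d p → m * #N (d ++ E ∷ p) ≡ m * #N d + #N p * m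
m*#N-after-E m d p = begin
  m * #N (d ++ E ∷ p)     ≡⟨ cong (m *_) (#N-++ d (E ∷ p)) ⟩
  m * (#N d + #N p)       ≡⟨ *-distribˡ-+ m (#N d) (#N p) ⟩
  m * #N d + m * #N p     ≡⟨ cong (m * #N d +_) (*-comm m (#N p)) ⟩
  m * #N d + #N p * m     ∎
  where open ≡-Reasoning

#E-after-E : ∀ d p → #E (d ++ E ∷ p) ≡ suc (#E d) + #E p
#E-after-E d p = trans (#E-++ d (E ∷ p)) (+-suc (#E d) (#E p))

horiz-after-E : ∀ m d p →
  horiz m (d ++ E ∷ p) ≡ (m * #N d + #N p * m) ∸ (suc (#E d) + #E p)
horiz-after-E m d p = cong₂ _∸_ (m*#N-after-E m d p) (#E-after-E d p)

horiz-at-E : ∀ m d → horiz m (d ++ E ∷ []) ≡ m * #N d ∸ suc (#E d)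
horiz-at-E m d =
  trans (horiz-after-E m d [])
        (cong₂ _∸_ (+-identityʳ (m * #N d)) (cong suc (+-identityʳ (#E d))))

-- Read from any point, p lowers the horizontal distance by exactly e.
Drops : ℕ → ℕ → Path → Set
Drops m e p = e + #N p * m ≡ #E p

FirstDrop : ℕ → ℕ → Path → Set
FirstDrop m e t = Drops m e t × (∀ p q → t ≡ p ++ q → q ≢ [] → ¬ Drops m e p)

DropSplit : ℕ → ℕ → Path → Path × Path → Set
DropSplit m e s (t , f) = s ≡ t ++ f × FirstDrop m e t

¬Drops-[] : ∀ m {e} → 1 ≤ e → ¬ Drops m e []
¬Drops-[] m {suc e} _ ()

module _ {m e : ℕ} {t : Path} where

  firstDrop-N : 1 ≤ e → FirstDrop m (e + m) t → FirstDrop m e (N ∷ t)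
  firstDrop-N 1≤e (drops , early) = trans (sym (+-assoc e m _)) drops , early′
    where
    early′ : ∀ p q → N ∷ t ≡ p ++ q → q ≢ [] → ¬ Drops m e p
    early′ []      q eq  q≢[] = ¬Drops-[] m 1≤e
    early′ (N ∷ p) q eq  q≢[] = early p q (∷-injectiveʳ eq) q≢[] ∘ trans (+-assoc e m _)
    early′ (E ∷ p) q ()

  firstDrop-N⁻ : FirstDrop m e (N ∷ t) → FirstDrop m (e + m) t
  firstDrop-N⁻ (drops , early) = trans (+-assoc e m _) drops , early′
    where
    early′ : ∀ p q → t ≡ p ++ q → q ≢ [] → ¬ Drops m (e + m) p
    early′ p q eq q≢[] =
      early (N ∷ p) q (cong (N ∷_) eq) q≢[] ∘ trans (sym (+-assoc e m _))

  firstDrop-E : FirstDrop m (suc e) t → FirstDrop m (suc (suc e)) (E ∷ t)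
  firstDrop-E (drops , early) = cong suc drops , early′
    where
    early′ : ∀ p q → E ∷ t ≡ p ++ q → q ≢ [] → ¬ Drops m (suc (suc e)) p
    early′ []      q eq q≢[] ()
    early′ (E ∷ p) q eq q≢[] = early p q (∷-injectiveʳ eq) q≢[] ∘ suc-injective
    early′ (N ∷ p) q ()

  firstDrop-E⁻ : FirstDrop m (suc (suc e)) (E ∷ t) → FirstDrop m (suc e) t
  firstDrop-E⁻ (drops , early) = suc-injective drops , early′
    where
    early′ : ∀ p q → t ≡ p ++ q → q ≢ [] → ¬ Drops m (suc e) p
    early′ p q eq q≢[] = early (E ∷ p) q (cong (E ∷_) eq) q≢[] ∘ cong suc

-- The clause for e = 0 is junk: a split is only asked for when 1 ≤ e.
splitAtDrop : ℕ → ℕ → Path → Path × Path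
splitAtDrop m e             []      = [] , []
splitAtDrop m e             (N ∷ s) = map₁ (N ∷_) (splitAtDrop m (e + m) s)
splitAtDrop m zero          (E ∷ s) = [] , []
splitAtDrop m (suc zero)    (E ∷ s) = E ∷ [] , s
splitAtDrop m (suc (suc e)) (E ∷ s) = map₁ (E ∷_) (splitAtDrop m (suc e) s)

splitAtDrop-sound : ∀ m e s → 1 ≤ e → e + #N s * m ≤ #E s →
                    DropSplit m e s (splitAtDrop m e s)
splitAtDrop-sound m (suc e) [] _ ()
splitAtDrop-sound m e (N ∷ s) 1≤e bound
  with splitAtDrop-sound m (e + m) s (≤-trans 1≤e (m≤m+n e m))
         (subst (_≤ #E s) (sym (+-assoc e m _)) bound)
... | s≡t++f , first = cong (N ∷_) s≡t++f , firstDrop-N 1≤e first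
splitAtDrop-sound m zero (E ∷ s) () _
splitAtDrop-sound m (suc zero) (E ∷ s) _ _ = refl , refl , early
  where
  early : ∀ p q → E ∷ [] ≡ p ++ q → q ≢ [] → ¬ Drops m 1 p
  early []      q eq  q≢[] ()
  early (E ∷ p) q eq  q≢[] _ = q≢[] (++-conicalʳ p q (sym (∷-injectiveʳ eq)))
  early (N ∷ p) q ()
splitAtDrop-sound m (suc (suc e)) (E ∷ s) _ bound
  with splitAtDrop-sound m (suc e) s (s≤s z≤n) (≤-pred bound)
... | s≡t++f , first = cong (E ∷_) s≡t++f , firstDrop-E first

splitAtDrop-unique : ∀ m e {s t f} → 1 ≤ e → DropSplit m e s (t , f) →
                     splitAtDrop m e s ≡ (t , f)
splitAtDrop-unique m e {t = []} 1≤e (_ , drops , _) = contradiction drops (¬Drops-[] m 1≤e)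
splitAtDrop-unique m e {t = N ∷ t} 1≤e (refl , first) =
  cong (map₁ (N ∷_))
    (splitAtDrop-unique m (e + m) (≤-trans 1≤e (m≤m+n e m)) (refl , firstDrop-N⁻ first))
splitAtDrop-unique m zero {t = E ∷ t} () _
splitAtDrop-unique m (suc zero) {t = E ∷ []} _ (refl , _) = refl
splitAtDrop-unique m (suc zero) {t = E ∷ x ∷ t} _ (refl , _ , early) =
  ⊥-elim (early (E ∷ []) (x ∷ t) refl (λ ()) refl)
splitAtDrop-unique m (suc (suc e)) {t = E ∷ t} _ (refl , first) =
  cong (map₁ (E ∷_)) (splitAtDrop-unique m (suc e) (s≤s z≤n) (refl , firstDrop-E⁻ first))

ReachesTouchPoint : ℕ → Path → Path → Set
ReachesTouchPoint m d t =
  (horiz m (d ++ E ∷ N ∷ t) ≡ horiz m (d ++ E ∷ [])) ×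
  (∀ p q → N ∷ t ≡ p ++ q → p ≢ [] → q ≢ [] →
     horiz m (d ++ E ∷ p) ≢ horiz m (d ++ E ∷ []))

flipValley : ℕ → Path → Path → Path
flipValley m d r = let (t , f) = splitAtDrop m m r in d ++ N ∷ t ++ E ∷ f

ValleyFlip : ℕ → Path → Path → Set
ValleyFlip m D D′ = ∃₂ λ d r → D ≡ d ++ E ∷ N ∷ r × D′ ≡ flipValley m d r

module _ {m n : ℕ} {D : Path} (dyck : IsDyck m n D) where

  dyck-bound-after-E : ∀ d p q → D ≡ d ++ E ∷ p ++ q →
                       suc (#E d) + #E p ≤ m * #N d + #N p * m
  dyck-bound-after-E d p q refl = subst₂ _≤_ (#E-after-E d p) (m*#N-after-E m d p)
    (proj₂ (proj₂ dyck) (d ++ E ∷ p) q (sym (++-assoc d (E ∷ p) q)))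

  dyck-bound-at-E : ∀ d q → D ≡ d ++ E ∷ q → suc (#E d) ≤ m * #N d
  dyck-bound-at-E d q eq =
    subst₂ _≤_ (+-identityʳ _) (+-identityʳ _) (dyck-bound-after-E d [] q eq)

  horiz-touch⇔Drops : ∀ d p q → D ≡ d ++ E ∷ N ∷ p ++ q →
    (horiz m (d ++ E ∷ N ∷ p) ≡ horiz m (d ++ E ∷ [])) ⇔ Drops m m p
  horiz-touch⇔Drops d p q eq = mk⇔
    (λ same → to arith (trans (sym (horiz-after-E m d (N ∷ p))) (trans same (horiz-at-E m d))))
    (λ drops → trans (horiz-after-E m d (N ∷ p))
                     (trans (from arith drops) (sym (horiz-at-E m d))))
    where
    arith : ((m * #N d + (m + #N p * m)) ∸ (suc (#E d) + #E p) ≡ m * #N d ∸ suc (#E d))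
            ⇔ Drops m m p
    arith = [m+o]∸[n+p]≡m∸n⇔o≡p (m * #N d) (suc (#E d)) (m + #N p * m) (#E p)
              (dyck-bound-at-E d (N ∷ p ++ q) eq) (dyck-bound-after-E d (N ∷ p) q eq)

  valley-suffix-drops : ∀ d r → D ≡ d ++ E ∷ N ∷ r → m + #N r * m ≤ #E r
  valley-suffix-drops d r refl = +-cancelˡ-≤ (m * #N d) (m + #N r * m) (#E r)
    (subst (_≤ m * #N d + #E r) endpoint (+-monoˡ-≤ (#E r) (dyck-bound-at-E d (N ∷ r) refl)))
    where
    endpoint : suc (#E d) + #E r ≡ m * #N d + (m + #N r * m)
    endpoint = begin
      suc (#E d) + #E r          ≡⟨ #E-after-E d (N ∷ r) ⟨
      #E (d ++ E ∷ N ∷ r)        ≡⟨ proj₁ (proj₂ dyck) ⟩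
      m * n                      ≡⟨ cong (m *_) (proj₁ dyck) ⟨
      m * #N (d ++ E ∷ N ∷ r)    ≡⟨ m*#N-after-E m d (N ∷ r) ⟩
      m * #N d + (m + #N r * m)  ∎
      where open ≡-Reasoning

  valley-index-≤ : ∀ d r → D ≡ d ++ E ∷ N ∷ r → suc (#N d) ≤ n
  valley-index-≤ d r refl = subst (suc (#N d) ≤_)
    (trans (sym (#N-++ d (E ∷ N ∷ r))) (proj₁ dyck)) (m<m+n (#N d) (s≤s z≤n))

  reachesTouchPoint⇔FirstDrop : ∀ d t f → D ≡ d ++ E ∷ N ∷ t ++ f →
    ReachesTouchPoint m d t ⇔ FirstDrop m m t
  reachesTouchPoint⇔FirstDrop d t f D≡ = mk⇔ firstDrop reaches
    where
    touch⇔ : ∀ p q → D ≡ d ++ E ∷ N ∷ p ++ q →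
             (horiz m (d ++ E ∷ N ∷ p) ≡ horiz m (d ++ E ∷ [])) ⇔ Drops m m p
    touch⇔ = horiz-touch⇔Drops d

    regroup : ∀ p q → t ≡ p ++ q → D ≡ d ++ E ∷ N ∷ p ++ q ++ f
    regroup p q refl = trans D≡ (cong (λ z → d ++ E ∷ N ∷ z) (++-assoc p q f))

    firstDrop : ReachesTouchPoint m d t → FirstDrop m m t
    firstDrop (touch , untouched) = to (touch⇔ t f D≡) touch , early
      where
      early : ∀ p q → t ≡ p ++ q → q ≢ [] → ¬ Drops m m p
      early p q t≡ q≢[] = untouched (N ∷ p) q (cong (N ∷_) t≡) (λ ()) q≢[]
                          ∘ from (touch⇔ p (q ++ f) (regroup p q t≡))

    reaches : FirstDrop m m t → ReachesTouchPoint m d t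
    reaches (drops , early) = from (touch⇔ t f D≡) drops , untouched
      where
      untouched : ∀ p q → N ∷ t ≡ p ++ q → p ≢ [] → q ≢ [] →
                  horiz m (d ++ E ∷ p) ≢ horiz m (d ++ E ∷ [])
      untouched []      q _    p≢[] _ = contradiction refl p≢[]
      untouched (N ∷ p) q N∷t≡ _ q≢[] =
        early p q t≡ q≢[] ∘ to (touch⇔ p (q ++ f) (regroup p q t≡))
        where
        t≡ : t ≡ p ++ q
        t≡ = ∷-injectiveʳ N∷t≡
      untouched (E ∷ p) q ()

  covers⇒valleyFlip : 1 ≤ m → ∀ {D′} → Covers m n D D′ → ValleyFlip m D D′
  covers⇒valleyFlip 1≤m
    (_ , _ , _ , d , _ , f , D≡ , _ , (t , refl) , touch , untouched , refl) =
    d , t ++ f , D≡ , cong (λ (t , f) → d ++ N ∷ t ++ E ∷ f) (sym split)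
    where
    split : splitAtDrop m m (t ++ f) ≡ (t , f)
    split = splitAtDrop-unique m m 1≤m
      (refl , to (reachesTouchPoint⇔FirstDrop d t f D≡) (touch , untouched))

  valleyFlip⇒covers : 1 ≤ m → ∀ {D′} → ValleyFlip m D D′ → Covers m n D D′
  valleyFlip⇒covers 1≤m (d , r , D≡ , refl) =
    suc (#N d) , s≤s z≤n , valley-index-≤ d r D≡ ,
    d , N ∷ t , f , D≡′ , refl , (t , refl) ,
    proj₁ touching , proj₂ touching , refl
    where
    t f : Path
    t = proj₁ (splitAtDrop m m r)
    f = proj₂ (splitAtDrop m m r)
    split : DropSplit m m r (t , f)
    split = splitAtDrop-sound m m r 1≤m (valley-suffix-drops d r D≡)
    D≡′ : D ≡ d ++ E ∷ N ∷ t ++ f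
    D≡′ = trans D≡ (cong (λ z → d ++ E ∷ N ∷ z) (proj₁ split))
    touching : ReachesTouchPoint m d t
    touching = from (reachesTouchPoint⇔FirstDrop d t f D≡′) (proj₂ split)

valleyFlips : ℕ → Path → List Path
valleyFlips m []          = []
valleyFlips m (N ∷ s)     = map (N ∷_) (valleyFlips m s)
valleyFlips m (E ∷ [])    = []
valleyFlips m (E ∷ N ∷ s) = flipValley m [] s ∷ map (E ∷_) (valleyFlips m (N ∷ s))
valleyFlips m (E ∷ E ∷ s) = map (E ∷_) (valleyFlips m (E ∷ s))

module _ {m : ℕ} where

  ∈-valleyFlips-∷E : ∀ s {D′} → D′ ∈ valleyFlips m s → E ∷ D′ ∈ valleyFlips m (E ∷ s)
  ∈-valleyFlips-∷E (N ∷ s) = there ∘ ∈-map⁺ (E ∷_)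
  ∈-valleyFlips-∷E (E ∷ s) = ∈-map⁺ (E ∷_)

  ∈-valleyFlips⁺ : ∀ d r → flipValley m d r ∈ valleyFlips m (d ++ E ∷ N ∷ r)
  ∈-valleyFlips⁺ []      r = here refl
  ∈-valleyFlips⁺ (N ∷ d) r = ∈-map⁺ (N ∷_) (∈-valleyFlips⁺ d r)
  ∈-valleyFlips⁺ (E ∷ d) r = ∈-valleyFlips-∷E (d ++ E ∷ N ∷ r) (∈-valleyFlips⁺ d r)

  ∷-valleyFlip : ∀ x {s D′} → ValleyFlip m s D′ → ValleyFlip m (x ∷ s) (x ∷ D′)
  ∷-valleyFlip x (d , r , refl , refl) = x ∷ d , r , refl , refl

  ∈-valleyFlips⁻ : ∀ D {D′} → D′ ∈ valleyFlips m D → ValleyFlip m D D′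
  ∈-valleyFlips⁻ (N ∷ s) D′∈ with ∈-map⁻ (N ∷_) D′∈
  ... | _ , y∈ , refl = ∷-valleyFlip N (∈-valleyFlips⁻ s y∈)
  ∈-valleyFlips⁻ (E ∷ N ∷ s) (here refl) = [] , s , refl , refl
  ∈-valleyFlips⁻ (E ∷ N ∷ s) (there D′∈) with ∈-map⁻ (E ∷_) D′∈
  ... | _ , y∈ , refl = ∷-valleyFlip E (∈-valleyFlips⁻ (N ∷ s) y∈)
  ∈-valleyFlips⁻ (E ∷ E ∷ s) D′∈ with ∈-map⁻ (E ∷_) D′∈
  ... | _ , y∈ , refl = ∷-valleyFlip E (∈-valleyFlips⁻ (E ∷ s) y∈)

  ∈-valleyFlips⇔ValleyFlip : ∀ D {D′} → (D′ ∈ valleyFlips m D) ⇔ ValleyFlip m D D′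
  ∈-valleyFlips⇔ValleyFlip D =
    mk⇔ (∈-valleyFlips⁻ D) λ { (d , r , refl , refl) → ∈-valleyFlips⁺ d r }

  valleyFlips-unique : ∀ D → Unique (valleyFlips m D)
  valleyFlips-unique []          = []
  valleyFlips-unique (N ∷ s)     = Unique.map⁺ ∷-injectiveʳ (valleyFlips-unique s)
  valleyFlips-unique (E ∷ [])    = []
  valleyFlips-unique (E ∷ N ∷ s) =
    All.map⁺ (All.universal (λ _ ()) _) ∷
    Unique.map⁺ ∷-injectiveʳ (valleyFlips-unique (N ∷ s))
  valleyFlips-unique (E ∷ E ∷ s) = Unique.map⁺ ∷-injectiveʳ (valleyFlips-unique (E ∷ s))

#EN : Path → ℕ
#EN []          = 0
#EN (N ∷ s)     = #EN s
#EN (E ∷ [])    = 0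
#EN (E ∷ N ∷ s) = suc (#EN (N ∷ s))
#EN (E ∷ E ∷ s) = #EN (E ∷ s)

#NN : Path → ℕ
#NN []          = 0
#NN (E ∷ s)     = #NN s
#NN (N ∷ [])    = 0
#NN (N ∷ N ∷ s) = suc (#NN (N ∷ s))
#NN (N ∷ E ∷ s) = #NN (E ∷ s)

length-valleyFlips : ∀ m D → length (valleyFlips m D) ≡ #EN D
length-valleyFlips m []          = refl
length-valleyFlips m (N ∷ s)     =
  trans (length-map (N ∷_) (valleyFlips m s)) (length-valleyFlips m s)
length-valleyFlips m (E ∷ [])    = refl
length-valleyFlips m (E ∷ N ∷ s) =
  cong suc (trans (length-map (E ∷_) (valleyFlips m (N ∷ s))) (length-valleyFlips m (N ∷ s)))
length-valleyFlips m (E ∷ E ∷ s) =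
  trans (length-map (E ∷_) (valleyFlips m (E ∷ s))) (length-valleyFlips m (E ∷ s))

mutual
  #N-∷N : ∀ s → #N (N ∷ s) ≡ suc (#NN (N ∷ s) + #EN (N ∷ s))
  #N-∷N []      = refl
  #N-∷N (N ∷ s) = cong suc (#N-∷N s)
  #N-∷N (E ∷ s) = cong suc (#N-∷E s)

  #N-∷E : ∀ s → #N (E ∷ s) ≡ #NN (E ∷ s) + #EN (E ∷ s)
  #N-∷E []      = refl
  #N-∷E (N ∷ s) = trans (#N-∷N s) (sym (+-suc (#NN (N ∷ s)) (#EN (N ∷ s))))
  #N-∷E (E ∷ s) = #N-∷E s

LA-from-≥ : ∀ x s → All (x ≤_) (LA-from x s)
LA-from-≥ x []      = []
LA-from-≥ x (N ∷ s) = ≤-refl ∷ LA-from-≥ x s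
LA-from-≥ x (E ∷ s) = All.map (≤-trans (n≤1+n x)) (LA-from-≥ (suc x) s)

unique-LA-from⇒#NN≡0 : ∀ x s → Unique (LA-from x s) → #NN s ≡ 0
unique-LA-from⇒#NN≡0 x []          _                = refl
unique-LA-from⇒#NN≡0 x (E ∷ s)     u                = unique-LA-from⇒#NN≡0 (suc x) s u
unique-LA-from⇒#NN≡0 x (N ∷ [])    _                = refl
unique-LA-from⇒#NN≡0 x (N ∷ N ∷ s) ((x≢x ∷ _) ∷ _) = contradiction refl x≢x
unique-LA-from⇒#NN≡0 x (N ∷ E ∷ s) (_ ∷ u)          = unique-LA-from⇒#NN≡0 x (E ∷ s) u

#NN≡0⇒unique-LA-from : ∀ x s → #NN s ≡ 0 → Unique (LA-from x s)
#NN≡0⇒unique-LA-from x []          _ = []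
#NN≡0⇒unique-LA-from x (E ∷ s)     h = #NN≡0⇒unique-LA-from (suc x) s h
#NN≡0⇒unique-LA-from x (N ∷ [])    _ = [] ∷ []
#NN≡0⇒unique-LA-from x (N ∷ E ∷ s) h =
  All.map <⇒≢ (LA-from-≥ (suc x) s) ∷ #NN≡0⇒unique-LA-from x (E ∷ s) h

unique-LA⇔#NN≡0 : ∀ D → Unique (LA D) ⇔ (#NN D ≡ 0)
unique-LA⇔#NN≡0 D = mk⇔ (unique-LA-from⇒#NN≡0 0 D) (#NN≡0⇒unique-LA-from 0 D)

module _ {m n : ℕ} {D : Path} (1≤m : 1 ≤ m) (dyck : IsDyck m n D) where

  ∈-valleyFlips⇔Covers : ∀ D′ → (D′ ∈ valleyFlips m D) ⇔ Covers m n D D′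
  ∈-valleyFlips⇔Covers D′ = ⇔.trans (∈-valleyFlips⇔ValleyFlip D)
    (mk⇔ (valleyFlip⇒covers dyck 1≤m) (covers⇒valleyFlip dyck 1≤m))

  outDegree⇔#EN≡ : ∀ k → OutDegree m n D k ⇔ (#EN D ≡ k)
  outDegree⇔#EN≡ k = mk⇔ count enumerate
    where
    count : OutDegree m n D k → #EN D ≡ k
    count (L , unique-L , ∈L⇔ , length-L) = begin
      #EN D                     ≡⟨ length-valleyFlips m D ⟨
      length (valleyFlips m D)  ≡⟨ unique∧set⇒length≡ (valleyFlips-unique D) unique-L same ⟩
      length L                  ≡⟨ length-L ⟩
      k                         ∎
      where
      open ≡-Reasoning
      same : ∀ {D′} → (D′ ∈ valleyFlips m D) ⇔ (D′ ∈ L)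
      same {D′} = ⇔.trans (∈-valleyFlips⇔Covers D′) (⇔.sym (∈L⇔ D′))

    enumerate : #EN D ≡ k → OutDegree m n D k
    enumerate #EN≡k = valleyFlips m D , valleyFlips-unique D , ∈-valleyFlips⇔Covers ,
                      trans (length-valleyFlips m D) #EN≡k

dyck-starts-with-N : ∀ {m n D} → 1 ≤ n → IsDyck m n D → ∃ λ s → D ≡ N ∷ s
dyck-starts-with-N {D = []} 1≤n (0≡n , _) = contradiction 0≡n (<⇒≢ 1≤n)
dyck-starts-with-N {m} {D = E ∷ s} _ (_ , _ , above) =
  contradiction (subst (1 ≤_) (*-zeroʳ m) (above (E ∷ []) s refl)) λ ()
dyck-starts-with-N {D = N ∷ s} _ _ = s , refl

mainTheorem4 : (m n : ℕ) → 1 ≤ m → 1 ≤ n → (D : Path) → IsDyck m n D →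
    OutDegree m n D (n ∸ 1) ⇔ Unique (LA D)
mainTheorem4 m n 1≤m 1≤n D dyck with dyck-starts-with-N {m} 1≤n dyck
... | s , refl = begin
  OutDegree m n (N ∷ s) (n ∸ 1)           ≈⟨ outDegree⇔#EN≡ 1≤m dyck (n ∸ 1) ⟩
  #EN (N ∷ s) ≡ n ∸ 1                     ≡⟨ cong (#EN (N ∷ s) ≡_) n∸1≡ ⟩
  #EN (N ∷ s) ≡ #NN (N ∷ s) + #EN (N ∷ s) ≈⟨ n≡m+n⇔m≡0 (#NN (N ∷ s)) (#EN (N ∷ s)) ⟩
  #NN (N ∷ s) ≡ 0                         ≈⟨ unique-LA⇔#NN≡0 (N ∷ s) ⟨
  Unique (LA (N ∷ s))                     ∎
  where
  open import Relation.Binary.Reasoning.Setoid (⇔-setoid 0ℓ)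
  n∸1≡ : n ∸ 1 ≡ #NN (N ∷ s) + #EN (N ∷ s)
  n∸1≡ = cong (_∸ 1) (trans (sym (proj₁ dyck)) (#N-∷N s))
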